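{- For every polymatroid ${\bf X}=(X,\operatorname{rk})$, $$\Theta\big(\mathcal{H}[{\bf X}](q,t)\big)=\sum_{A\subseteq X}q^{\operatorname{rk}(A)}t^{|A|}.$$
   Context: A polymatroid is ${\bf X}=(X,\operatorname{rk})$, $X$ finite, $\operatorname{rk}$ from subsets of $X$ to $\{0,1,2,\dots\}$ with $\operatorname{rk}(\emptyset)=0$, monotone and submodular; ${\bf X}|_A=(A,\operatorname{rk}|_A)$. $\mathrm{Sym}=\mathbb{Z}[e_1,e_2,\dots]$ with Schur basis $s_\lambda$, $\overline{\mathrm{Sym}}=\mathbb{Z}[[e_1,e_2,\dots]]$, $\sigma=1+s_1+s_2+\cdots$. $\mathcal{P}[{\bf X}]=1$ if $X=\emptyset$, otherwise the sum of the homogeneous components of degrees $0,\dots,|X|-1$ of $-\sum_{A\subsetneq X}\mathcal{P}[{\bf X}|_A]\sigma^{\operatorname{rk}(X)-\operatorname{rk}(A)}(-1)^{|X|-|A|}$. $\mathcal{H}[{\bf X}](q,t)=\sum_{A\subseteq X}\mathcal{P}[{\bf X}|_A]q^{\operatorname{rk}(A)}t^{|A|}$. $\Theta:\mathrm{Sym}\otimes\mathbb{Q}(q,t)\to\mathbb{Q}(q,t)$ is the $\mathbb{Q}(q,t)$-linear map with $\Theta(s_\lambda)=1$ if $\lambda$ is the empty partition and $\Theta(s_\lambda)=0$ otherwise. -}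

module Defs where

open import Data.Nat as ℕ using (ℕ; zero; suc; _≤_; _<_; _∸_)
open import Data.Nat.Properties using () renaming (_≟_ to _≟ℕ_; _<?_ to _<ℕ?_)
open import Data.Integer as ℤ using (ℤ; +_; -_)
open import Data.Bool using (Bool; true; false; if_then_else_)
open import Data.List as List using (List; []; _∷_; _++_; map; concatMap; filter; foldr)
open import Data.Product using (_×_; _,_; proj₁; proj₂)
open import Data.Vec using (Vec; []; _∷_)
open import Data.Fin.Subset using (Subset; inside; outside; ⊥; _∪_; _∩_; _⊆_; _⊂_; ∣_∣)
open import Data.Fin.Subset.Properties using (_⊂?_)
open import Relation.Nullary using (does)
open import Relation.Nullary.Decidable using (⌊_⌋)
open import Relation.Binary.PropositionalEquality using (_≡_)

record Polymatroid (n : ℕ) : Set where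
  field
    rk       : Subset n → ℕ
    rk-empty : rk ⊥ ≡ 0
    rk-mono  : ∀ {A B} → A ⊆ B → rk A ≤ rk B
    rk-submod : ∀ A B → rk (A ∪ B) ℕ.+ rk (A ∩ B) ≤ rk A ℕ.+ rk B

allSubsets : (n : ℕ) → List (Subset n)
allSubsets zero    = [] ∷ []
allSubsets (suc n) = map (outside ∷_) (allSubsets n) ++ map (inside ∷_) (allSubsets n)

properSubsets : ∀ {n} → Subset n → List (Subset n)
properSubsets {n} A = filter (λ B → B ⊂? A) (allSubsets n)

-- Sym = ℤ[e₁, e₂, …], elements represented as formal ℤ-linear
-- combinations of monomials in the e's.  A monomial is a list of
-- indices; the index i stands for the generator e_{i+1} (deg e_{i+1} = i+1).

Mon : Set
Mon = List ℕ

degMon : Mon → ℕ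
degMon = foldr (λ i d → suc i ℕ.+ d) 0

Sym : Set
Sym = List (ℤ × Mon)

0S : Sym
0S = []

1S : Sym
1S = (ℤ.1ℤ , []) ∷ []

eS : ℕ → Sym
eS i = (ℤ.1ℤ , i ∷ []) ∷ []

_+S_ : Sym → Sym → Sym
_+S_ = _++_

negS : Sym → Sym
negS = map (λ { (c , m) → (- c , m) })

scaleS : ℤ → Sym → Sym
scaleS k = map (λ { (c , m) → (k ℤ.* c , m) })

_*S_ : Sym → Sym → Sym
f *S g = concatMap (λ { (c , m) → map (λ { (c' , m') → (c ℤ.* c' , m ++ m') }) g }) f

sumS : List Sym → Sym
sumS = foldr _+S_ 0S

powS : Sym → ℕ → Sym
powS f zero    = 1S
powS f (suc k) = f *S powS f k

trunc : ℕ → Sym → Sym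
trunc d = filter (λ t → degMon (proj₂ t) <ℕ? d)

sgn : ℕ → ℤ
sgn zero    = ℤ.1ℤ
sgn (suc m) = - sgn m

-- Complete homogeneous functions h_m = s_(m), via the defining relation
-- Σ_{i=0}^{m} (-1)^i e_i h_{m-i} = 0 (m ≥ 1), h_0 = 1.
-- hList m = [h_m, h_{m-1}, …, h_0].

indexed : ∀ {A : Set} → ℕ → List A → List (ℕ × A)
indexed k []       = []
indexed k (x ∷ xs) = (k , x) ∷ indexed (suc k) xs

hList : ℕ → List Sym
hList zero    = 1S ∷ []
hList (suc m) =
  sumS (map (λ { (k , h) → scaleS (sgn k) (eS k *S h) }) (indexed 0 (hList m)))
  ∷ hList m

-- σ = 1 + s₁ + s₂ + ⋯, truncated to degrees < d (s_(m) = h_m)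
σ< : ℕ → Sym
σ< zero    = 0S
σ< (suc d) = sumS (hList d)

σpow< : ℕ → ℕ → Sym
σpow< d k = trunc d (powS (σ< d) k)

-- The polynomial P[X|_A] (restriction of X to A ⊆ X).  Defined with
-- fuel; P A uses fuel ∣ A ∣, which suffices since proper subsets are
-- strictly smaller (the fuel-exhausted branch is never reached).

module _ {n : ℕ} (X : Polymatroid n) where
  open Polymatroid X

  isEmpty : Subset n → Bool
  isEmpty A = ⌊ ∣ A ∣ ≟ℕ 0 ⌋

  Pfuel : ℕ → Subset n → Sym
  Pfuel fuel A with isEmpty A
  ... | true = 1S
  Pfuel zero     A | false = 1S
  Pfuel (suc f) A | false =
    trunc ∣ A ∣ (negS (sumS (map (λ B →
        scaleS (sgn (∣ A ∣ ∸ ∣ B ∣))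
               (Pfuel f B *S σpow< ∣ A ∣ (rk A ∸ rk B)))
      (properSubsets A))))

  P : Subset n → Sym
  P A = Pfuel ∣ A ∣ A

-- Polynomials in q, t with coefficients in R: formal sums of terms
-- c · q^a t^b, represented as lists of (c , a , b).

Poly : Set → Set
Poly R = List (R × ℕ × ℕ)

coeff : Poly ℤ → ℕ → ℕ → ℤ
coeff p i j = foldr (λ { (c , a , b) s →
  if ⌊ a ≟ℕ i ⌋ then (if ⌊ b ≟ℕ j ⌋ then c ℤ.+ s else s) else s }) (+ 0) p

_≈P_ : Poly ℤ → Poly ℤ → Set
p ≈P r = ∀ i j → coeff p i j ≡ coeff r i j

-- Θ on Sym: coefficient of s_∅ = 1 in the Schur expansion, i.e. the
-- degree-0 component (all s_λ with λ ≠ ∅ are homogeneous of positive degree).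
ΘS : Sym → ℤ
ΘS f = foldr (λ { (c , m) s → if ⌊ degMon m ≟ℕ 0 ⌋ then c ℤ.+ s else s }) (+ 0) f

Θ : Poly Sym → Poly ℤ
Θ = map (λ { (f , a , b) → (ΘS f , a , b) })

𝓗 : ∀ {n} → Polymatroid n → Poly Sym
𝓗 {n} X = map (λ A → (P X A , Polymatroid.rk X A , ∣ A ∣)) (allSubsets n)

rankGen : ∀ {n} → Polymatroid n → Poly ℤ
rankGen {n} X = map (λ A → (ℤ.1ℤ , Polymatroid.rk X A , ∣ A ∣)) (allSubsets n)

{-# OPTIONS --safe #-}
module Submission where

-- Θ only sees degree-0 parts, and extracting the degree-0 part of an
-- element of Sym is a ring homomorphism to ℤ that is unchanged by
-- truncation to positive degree and sends σ to 1.  Hence Θ P[X|_A] = 1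
-- for every A: for A = ∅ by definition, and otherwise by induction,
-- Θ P[X|_A] = −Σ_{B ⊊ A} (−1)^{|A|−|B|} = 1, because the full alternating
-- sum over all B ⊆ A vanishes when A ≠ ∅.

open import Data.Nat as ℕ using (ℕ; zero; suc; _≤_; _∸_)
open import Data.Nat.Properties using (+-∸-assoc) renaming (_≟_ to _≟ℕ_)
open import Data.Integer using (ℤ; -_; _+_; _*_; _^_; 0ℤ; 1ℤ; -1ℤ)
import Data.Integer.Properties as ℤ
open import Data.Bool using (Bool; true; false; if_then_else_)
open import Data.List using (List; []; _∷_; _++_; map; filter)
open import Data.List.Properties using (map-∘; map-cong; ++-identityʳ)
open import Data.Product using (_×_; _,_)
open import Data.Vec using ([]; _∷_)
open import Data.Fin.Subset using (Subset; inside; outside; ∣_∣)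
open import Data.Fin.Subset.Properties using (_⊂?_; _⊆?_; p⊆q⇒∣p∣≤∣q∣)
open import Function using (_∘_)
open import Relation.Nullary using (Dec; does; yes)
open import Relation.Nullary.Decidable using (⌊_⌋)
open import Relation.Binary.PropositionalEquality
open ≡-Reasoning

open import Defs

-- A monomial has degree 0 exactly when it is the empty list, so ΘS
-- reduces by matching on the monomial of the leading term.
ΘS-++ : ∀ f g → ΘS (f ++ g) ≡ ΘS f + ΘS g
ΘS-++ []                g = sym (ℤ.+-identityˡ (ΘS g))
ΘS-++ ((c , [])    ∷ f) g = trans (cong (c +_) (ΘS-++ f g)) (sym (ℤ.+-assoc c (ΘS f) (ΘS g)))
ΘS-++ ((c , _ ∷ _) ∷ f) g = ΘS-++ f g

ΘS-negS : ∀ f → ΘS (negS f) ≡ - ΘS f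
ΘS-negS []                = refl
ΘS-negS ((c , [])    ∷ f) = trans (cong (- c +_) (ΘS-negS f)) (sym (ℤ.neg-distrib-+ c (ΘS f)))
ΘS-negS ((c , _ ∷ _) ∷ f) = ΘS-negS f

ΘS-scaleS : ∀ k f → ΘS (scaleS k f) ≡ k * ΘS f
ΘS-scaleS k []                = sym (ℤ.*-zeroʳ k)
ΘS-scaleS k ((c , [])    ∷ f) = trans (cong (k * c +_) (ΘS-scaleS k f)) (sym (ℤ.*-distribˡ-+ k c (ΘS f)))
ΘS-scaleS k ((c , _ ∷ _) ∷ f) = ΘS-scaleS k f

ΘS-constant-*S : ∀ c g → ΘS (((c , []) ∷ []) *S g) ≡ c * ΘS g
ΘS-constant-*S c []                 = sym (ℤ.*-zeroʳ c)
ΘS-constant-*S c ((c' , [])    ∷ g) = trans (cong (c * c' +_) (ΘS-constant-*S c g)) (sym (ℤ.*-distribˡ-+ c c' (ΘS g)))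
ΘS-constant-*S c ((c' , _ ∷ _) ∷ g) = ΘS-constant-*S c g

ΘS-positive-*S : ∀ c i m g → ΘS (((c , i ∷ m) ∷ []) *S g) ≡ 0ℤ
ΘS-positive-*S c i m []             = refl
ΘS-positive-*S c i m ((c' , m') ∷ g) = ΘS-positive-*S c i m g

*S-∷ˡ : ∀ t f g → (t ∷ f) *S g ≡ ((t ∷ []) *S g) ++ (f *S g)
*S-∷ˡ (c , m) f g = cong (_++ f *S g) (sym (++-identityʳ _))

ΘS-*S : ∀ f g → ΘS (f *S g) ≡ ΘS f * ΘS g
ΘS-*S [] g = refl
ΘS-*S ((c , m) ∷ f) g = begin
  ΘS (((c , m) ∷ f) *S g)                   ≡⟨ cong ΘS (*S-∷ˡ (c , m) f g) ⟩
  ΘS (((c , m) ∷ []) *S g ++ f *S g)        ≡⟨ ΘS-++ (((c , m) ∷ []) *S g) (f *S g) ⟩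
  ΘS (((c , m) ∷ []) *S g) + ΘS (f *S g)    ≡⟨ cong₂ _+_ (leading m) (ΘS-*S f g) ⟩
  ΘS ((c , m) ∷ []) * ΘS g + ΘS f * ΘS g    ≡⟨ sym (ℤ.*-distribʳ-+ (ΘS g) (ΘS ((c , m) ∷ [])) (ΘS f)) ⟩
  (ΘS ((c , m) ∷ []) + ΘS f) * ΘS g         ≡⟨ cong (_* ΘS g) (sym (ΘS-++ ((c , m) ∷ []) f)) ⟩
  ΘS ((c , m) ∷ f) * ΘS g                   ∎
  where
  leading : ∀ m → ΘS (((c , m) ∷ []) *S g) ≡ ΘS ((c , m) ∷ []) * ΘS g
  leading []      = trans (ΘS-constant-*S c g) (cong (_* ΘS g) (sym (ℤ.+-identityʳ c)))
  leading (i ∷ m) = trans (ΘS-positive-*S c i m g) (sym (ℤ.*-zeroˡ (ΘS g)))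

ΘS-powS : ∀ f k → ΘS (powS f k) ≡ ΘS f ^ k
ΘS-powS f zero    = refl
ΘS-powS f (suc k) = trans (ΘS-*S f (powS f k)) (cong (ΘS f *_) (ΘS-powS f k))

ΘS-trunc : ∀ d f → ⌊ d ≟ℕ 0 ⌋ ≡ false → ΘS (trunc d f) ≡ ΘS f
ΘS-trunc (suc d) []                _   = refl
ΘS-trunc (suc d) ((c , [])    ∷ f) d≢0 = cong (c +_) (ΘS-trunc (suc d) f d≢0)
ΘS-trunc (suc d) ((c , i ∷ m) ∷ f) d≢0 with does (suc (i ℕ.+ degMon m) ℕ.<? suc d)
... | true  = ΘS-trunc (suc d) f d≢0
... | false = ΘS-trunc (suc d) f d≢0

ΘS-sumS-map-≡0 : ∀ {A : Set} (φ : A → Sym) → (∀ a → ΘS (φ a) ≡ 0ℤ) →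
                 ∀ as → ΘS (sumS (map φ as)) ≡ 0ℤ
ΘS-sumS-map-≡0 φ φ≡0 []       = refl
ΘS-sumS-map-≡0 φ φ≡0 (a ∷ as) =
  trans (ΘS-++ (φ a) (sumS (map φ as))) (cong₂ _+_ (φ≡0 a) (ΘS-sumS-map-≡0 φ φ≡0 as))

ΘS-σ< : ∀ d → ΘS (σ< (suc d)) ≡ 1ℤ
ΘS-σ< zero    = refl
ΘS-σ< (suc d) = begin
  ΘS (newest ++ sumS (hList d))      ≡⟨ ΘS-++ newest (sumS (hList d)) ⟩
  ΘS newest + ΘS (sumS (hList d))    ≡⟨ cong₂ _+_ (ΘS-sumS-map-≡0 _ e-term≡0 (indexed 0 (hList d))) (ΘS-σ< d) ⟩
  1ℤ                                 ∎
  where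
  newest : Sym
  newest = sumS (map (λ { (k , h) → scaleS (sgn k) (eS k *S h) }) (indexed 0 (hList d)))
  e-term≡0 : ∀ ((k , h) : ℕ × Sym) → ΘS (scaleS (sgn k) (eS k *S h)) ≡ 0ℤ
  e-term≡0 (k , h) = trans (ΘS-scaleS (sgn k) (eS k *S h))
    (trans (cong (sgn k *_) (ΘS-positive-*S 1ℤ k [] h)) (ℤ.*-zeroʳ (sgn k)))

ΘS-σpow< : ∀ d k → ⌊ d ≟ℕ 0 ⌋ ≡ false → ΘS (σpow< d k) ≡ 1ℤ
ΘS-σpow< (suc d) k _ = begin
  ΘS (trunc (suc d) (powS (σ< (suc d)) k))  ≡⟨ ΘS-trunc (suc d) (powS (σ< (suc d)) k) refl ⟩
  ΘS (powS (σ< (suc d)) k)                  ≡⟨ ΘS-powS (σ< (suc d)) k ⟩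
  ΘS (σ< (suc d)) ^ k                       ≡⟨ cong (_^ k) (ΘS-σ< d) ⟩
  1ℤ ^ k                                    ≡⟨ ℤ.^-zeroˡ k ⟩
  1ℤ                                        ∎

sumWhere : {A : Set} → (A → Bool) → (A → ℤ) → List A → ℤ
sumWhere p w []       = 0ℤ
sumWhere p w (x ∷ xs) = if p x then w x + sumWhere p w xs else sumWhere p w xs

sumWhere-++ : ∀ {A : Set} (p : A → Bool) w xs ys →
              sumWhere p w (xs ++ ys) ≡ sumWhere p w xs + sumWhere p w ys
sumWhere-++ p w []       ys = sym (ℤ.+-identityˡ _)
sumWhere-++ p w (x ∷ xs) ys with p x
... | true  = trans (cong (w x +_) (sumWhere-++ p w xs ys)) (sym (ℤ.+-assoc (w x) _ _))
... | false = sumWhere-++ p w xs ys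

sumWhere-map : ∀ {A B : Set} (p : B → Bool) w (f : A → B) xs →
               sumWhere p w (map f xs) ≡ sumWhere (p ∘ f) (w ∘ f) xs
sumWhere-map p w f []       = refl
sumWhere-map p w f (x ∷ xs) with p (f x)
... | true  = cong (w (f x) +_) (sumWhere-map p w f xs)
... | false = sumWhere-map p w f xs

sumWhere-cong : ∀ {A : Set} (p : A → Bool) {w w' : A → ℤ} → (∀ x → p x ≡ true → w x ≡ w' x) →
                ∀ xs → sumWhere p w xs ≡ sumWhere p w' xs
sumWhere-cong p w≡w' []       = refl
sumWhere-cong p w≡w' (x ∷ xs) with p x in px
... | true  = cong₂ _+_ (w≡w' x px) (sumWhere-cong p w≡w' xs)
... | false = sumWhere-cong p w≡w' xs

sumWhere-nowhere : ∀ {A : Set} w xs → sumWhere {A} (λ _ → false) w xs ≡ 0ℤ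
sumWhere-nowhere w []       = refl
sumWhere-nowhere w (x ∷ xs) = sumWhere-nowhere w xs

sumWhere-neg : ∀ {A : Set} (p : A → Bool) w xs → sumWhere p (-_ ∘ w) xs ≡ - sumWhere p w xs
sumWhere-neg p w []       = refl
sumWhere-neg p w (x ∷ xs) with p x
... | true  = trans (cong (- w x +_) (sumWhere-neg p w xs)) (sym (ℤ.neg-distrib-+ (w x) _))
... | false = sumWhere-neg p w xs

sumWhere-allSubsets : ∀ {n} (p : Subset (suc n) → Bool) w →
  sumWhere p w (allSubsets (suc n)) ≡
    sumWhere (p ∘ (outside ∷_)) (w ∘ (outside ∷_)) (allSubsets n)
  + sumWhere (p ∘ (inside ∷_))  (w ∘ (inside ∷_))  (allSubsets n)
sumWhere-allSubsets {n} p w =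
  trans (sumWhere-++ p w (map (outside ∷_) (allSubsets n)) (map (inside ∷_) (allSubsets n)))
        (cong₂ _+_ (sumWhere-map p w (outside ∷_) (allSubsets n)) (sumWhere-map p w (inside ∷_) (allSubsets n)))

ΘS-sumS-filter : ∀ {A : Set} {P : A → Set} (P? : ∀ a → Dec (P a)) (g : A → Sym) →
                 ∀ xs → ΘS (sumS (map g (filter P? xs))) ≡ sumWhere (does ∘ P?) (ΘS ∘ g) xs
ΘS-sumS-filter P? g []       = refl
ΘS-sumS-filter P? g (x ∷ xs) with does (P? x)
... | true  = trans (ΘS-++ (g x) _) (cong (ΘS (g x) +_) (ΘS-sumS-filter P? g xs))
... | false = ΘS-sumS-filter P? g xs

altSum⊆ altSum⊂ : ∀ {n} → Subset n → ℤ
altSum⊆ {n} A = sumWhere (λ B → does (B ⊆? A)) (λ B → sgn (∣ A ∣ ∸ ∣ B ∣)) (allSubsets n)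
altSum⊂ {n} A = sumWhere (λ B → does (B ⊂? A)) (λ B → sgn (∣ A ∣ ∸ ∣ B ∣)) (allSubsets n)

sgn-suc-∸ : ∀ {a b} → b ≤ a → sgn (suc a ∸ b) ≡ - sgn (a ∸ b)
sgn-suc-∸ b≤a = cong sgn (+-∸-assoc 1 b≤a)

altSum⊆-shift : ∀ {n} (A : Subset n) →
  sumWhere (λ B → does (B ⊆? A)) (λ B → sgn (suc ∣ A ∣ ∸ ∣ B ∣)) (allSubsets n) ≡ - altSum⊆ A
altSum⊆-shift {n} A =
  trans (sumWhere-cong (λ B → does (B ⊆? A)) sign-flips (allSubsets n))
        (sumWhere-neg _ _ (allSubsets n))
  where
  sign-flips : ∀ B → does (B ⊆? A) ≡ true → sgn (suc ∣ A ∣ ∸ ∣ B ∣) ≡ - sgn (∣ A ∣ ∸ ∣ B ∣)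
  sign-flips B _ with B ⊆? A
  ... | yes B⊆A = sgn-suc-∸ (p⊆q⇒∣p∣≤∣q∣ B⊆A)

altSum⊆-outside : ∀ {n} (A : Subset n) → altSum⊆ (outside ∷ A) ≡ altSum⊆ A
altSum⊆-outside {n} A = begin
  altSum⊆ (outside ∷ A)
    ≡⟨ sumWhere-allSubsets (λ B → does (B ⊆? (outside ∷ A))) (λ B → sgn (∣ outside ∷ A ∣ ∸ ∣ B ∣)) ⟩
  altSum⊆ A + sumWhere (λ _ → false) _ (allSubsets n)  ≡⟨ cong (altSum⊆ A +_) (sumWhere-nowhere _ (allSubsets n)) ⟩
  altSum⊆ A + 0ℤ                                       ≡⟨ ℤ.+-identityʳ _ ⟩
  altSum⊆ A                                            ∎

altSum⊂-outside : ∀ {n} (A : Subset n) → altSum⊂ (outside ∷ A) ≡ altSum⊂ A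
altSum⊂-outside {n} A = begin
  altSum⊂ (outside ∷ A)
    ≡⟨ sumWhere-allSubsets (λ B → does (B ⊂? (outside ∷ A))) (λ B → sgn (∣ outside ∷ A ∣ ∸ ∣ B ∣)) ⟩
  altSum⊂ A + sumWhere (λ _ → false) _ (allSubsets n)  ≡⟨ cong (altSum⊂ A +_) (sumWhere-nowhere _ (allSubsets n)) ⟩
  altSum⊂ A + 0ℤ                                       ≡⟨ ℤ.+-identityʳ _ ⟩
  altSum⊂ A                                            ∎

-- The subsets of inside ∷ A pair off as outside ∷ B and inside ∷ B, with opposite signs.
altSum⊆-inside : ∀ {n} (A : Subset n) → altSum⊆ (inside ∷ A) ≡ 0ℤ
altSum⊆-inside A =
  trans (sumWhere-allSubsets (λ B → does (B ⊆? (inside ∷ A))) (λ B → sgn (∣ inside ∷ A ∣ ∸ ∣ B ∣)))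
        (trans (cong (_+ altSum⊆ A) (altSum⊆-shift A)) (ℤ.+-inverseˡ (altSum⊆ A)))

altSum⊂-inside : ∀ {n} (A : Subset n) → altSum⊂ (inside ∷ A) ≡ - altSum⊆ A + altSum⊂ A
altSum⊂-inside A =
  trans (sumWhere-allSubsets (λ B → does (B ⊂? (inside ∷ A))) (λ B → sgn (∣ inside ∷ A ∣ ∸ ∣ B ∣)))
        (cong (_+ altSum⊂ A) (altSum⊆-shift A))

altSum⊂+1≡altSum⊆ : ∀ {n} (A : Subset n) → altSum⊂ A + 1ℤ ≡ altSum⊆ A
altSum⊂+1≡altSum⊆ []            = refl
altSum⊂+1≡altSum⊆ (outside ∷ A) = trans (cong (_+ 1ℤ) (altSum⊂-outside A))
                                        (trans (altSum⊂+1≡altSum⊆ A) (sym (altSum⊆-outside A)))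
altSum⊂+1≡altSum⊆ (inside ∷ A)  = begin
  altSum⊂ (inside ∷ A) + 1ℤ              ≡⟨ cong (_+ 1ℤ) (altSum⊂-inside A) ⟩
  (- altSum⊆ A + altSum⊂ A) + 1ℤ         ≡⟨ ℤ.+-assoc (- altSum⊆ A) (altSum⊂ A) 1ℤ ⟩
  - altSum⊆ A + (altSum⊂ A + 1ℤ)         ≡⟨ cong (- altSum⊆ A +_) (altSum⊂+1≡altSum⊆ A) ⟩
  - altSum⊆ A + altSum⊆ A                ≡⟨ ℤ.+-inverseˡ (altSum⊆ A) ⟩
  0ℤ                                     ≡⟨ sym (altSum⊆-inside A) ⟩
  altSum⊆ (inside ∷ A)                   ∎

altSum⊆-nonempty : ∀ {n} (A : Subset n) → ⌊ ∣ A ∣ ≟ℕ 0 ⌋ ≡ false → altSum⊆ A ≡ 0ℤ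
altSum⊆-nonempty (outside ∷ A) A≢∅ = trans (altSum⊆-outside A) (altSum⊆-nonempty A A≢∅)
altSum⊆-nonempty (inside ∷ A)  _   = altSum⊆-inside A

altSum⊂-nonempty : ∀ {n} (A : Subset n) → ⌊ ∣ A ∣ ≟ℕ 0 ⌋ ≡ false → altSum⊂ A ≡ -1ℤ
altSum⊂-nonempty A A≢∅ = begin
  altSum⊂ A                        ≡⟨ sym (ℤ.+-identityʳ (altSum⊂ A)) ⟩
  altSum⊂ A + (1ℤ + -1ℤ)           ≡⟨ sym (ℤ.+-assoc (altSum⊂ A) 1ℤ -1ℤ) ⟩
  (altSum⊂ A + 1ℤ) + -1ℤ           ≡⟨ cong (_+ -1ℤ) (trans (altSum⊂+1≡altSum⊆ A) (altSum⊆-nonempty A A≢∅)) ⟩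
  -1ℤ                              ∎

module _ {n : ℕ} (X : Polymatroid n) where
  open Polymatroid X

  ΘS-Pfuel : ∀ fuel A → ΘS (Pfuel X fuel A) ≡ 1ℤ
  ΘS-Pfuel fuel    A with isEmpty X A in A≢∅
  ΘS-Pfuel fuel    A | true  = refl
  ΘS-Pfuel zero    A | false = refl
  ΘS-Pfuel (suc f) A | false = begin
    ΘS (trunc ∣ A ∣ (negS Σterms))                                ≡⟨ ΘS-trunc ∣ A ∣ (negS Σterms) A≢∅ ⟩
    ΘS (negS Σterms)                                             ≡⟨ ΘS-negS Σterms ⟩
    - ΘS Σterms                                                  ≡⟨ cong -_ (ΘS-sumS-filter (_⊂? A) term (allSubsets n)) ⟩
    - sumWhere (λ B → does (B ⊂? A)) (ΘS ∘ term) (allSubsets n)  ≡⟨ cong -_ (sumWhere-cong _ ΘS-term (allSubsets n)) ⟩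
    - altSum⊂ A                                                  ≡⟨ cong -_ (altSum⊂-nonempty A A≢∅) ⟩
    1ℤ                                                           ∎
    where
    term : Subset n → Sym
    term B = scaleS (sgn (∣ A ∣ ∸ ∣ B ∣)) (Pfuel X f B *S σpow< ∣ A ∣ (rk A ∸ rk B))

    Σterms : Sym
    Σterms = sumS (map term (properSubsets A))

    ΘS-term : ∀ B → does (B ⊂? A) ≡ true → ΘS (term B) ≡ sgn (∣ A ∣ ∸ ∣ B ∣)
    ΘS-term B _ = begin
      ΘS (term B)
        ≡⟨ ΘS-scaleS (sgn (∣ A ∣ ∸ ∣ B ∣)) (Pfuel X f B *S σpow< ∣ A ∣ (rk A ∸ rk B)) ⟩
      sgn (∣ A ∣ ∸ ∣ B ∣) * ΘS (Pfuel X f B *S σpow< ∣ A ∣ (rk A ∸ rk B))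
        ≡⟨ cong (sgn (∣ A ∣ ∸ ∣ B ∣) *_) (ΘS-*S (Pfuel X f B) (σpow< ∣ A ∣ (rk A ∸ rk B))) ⟩
      sgn (∣ A ∣ ∸ ∣ B ∣) * (ΘS (Pfuel X f B) * ΘS (σpow< ∣ A ∣ (rk A ∸ rk B)))
        ≡⟨ cong (sgn (∣ A ∣ ∸ ∣ B ∣) *_) (cong₂ _*_ (ΘS-Pfuel f B) (ΘS-σpow< ∣ A ∣ (rk A ∸ rk B) A≢∅)) ⟩
      sgn (∣ A ∣ ∸ ∣ B ∣) * 1ℤ
        ≡⟨ ℤ.*-identityʳ _ ⟩
      sgn (∣ A ∣ ∸ ∣ B ∣)
        ∎

  Θ-𝓗 : Θ (𝓗 X) ≡ rankGen X
  Θ-𝓗 = trans (sym (map-∘ (allSubsets n)))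
               (map-cong (λ A → cong (_, rk A , ∣ A ∣) (ΘS-Pfuel ∣ A ∣ A)) (allSubsets n))

corollary2p7 : (n : ℕ) (X : Polymatroid n) → Θ (𝓗 X) ≈P rankGen X
corollary2p7 n X i j = cong (λ p → coeff p i j) (Θ-𝓗 X)
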